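{- Let $\{q_n\}$ be the Fibonacci Quilt sequence. Then: (1) for $n\ge7$, $2q_n=q_{n+2}+q_{n-5}$; (2) for $n\ge8$, $q_n+q_{n-2}=q_{n+1}+q_{n-5}$; (3) for $n\ge10$, $q_n+q_{n-3}=q_{n+1}+q_{n-8}$.
   Context: Given an increasing sequence of positive integers $\{q_i\}_{i\ge1}$, a decomposition $m=q_{\ell_1}+\cdots+q_{\ell_t}$ with $q_{\ell_1}>\cdots>q_{\ell_t}$ is FQ-legal if $|\ell_i-\ell_j|\notin\{0,1,3,4\}$ for all $i\neq j$ and $\{1,3\}\not\subset\{\ell_1,\dots,\ell_t\}$. The Fibonacci Quilt sequence is the increasing sequence $\{q_i\}_{i\ge1}$ of positive integers in which each $q_i$ is the smallest positive integer with no FQ-legal decomposition using elements of $\{q_1,\dots,q_{i-1}\}$ (so it begins $1,2,3,4,5,7,9,12,16,\dots$). -}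

module Defs where

open import Data.Nat using (ℕ; zero; suc; _+_; _*_; _∸_; _≤_; _<_; _>_)
open import Data.List using (List; map)
open import Data.Nat.ListAction using (sum)
open import Data.List.Relation.Unary.All using (All)
open import Data.List.Relation.Unary.AllPairs using (AllPairs)
open import Data.List.Membership.Propositional using (_∈_)
open import Data.Product using (_×_; ∃)
open import Data.Sum using (_⊎_)
open import Relation.Nullary using (¬_)
open import Relation.Binary.PropositionalEquality using (_≡_)

dist : ℕ → ℕ → ℕ
dist a b = (a ∸ b) + (b ∸ a)

Forbidden : ℕ → Set
Forbidden d = d ≡ 0 ⊎ d ≡ 1 ⊎ d ≡ 3 ⊎ d ≡ 4

FQLegal : List ℕ → Set
FQLegal L = AllPairs _>_ L
          × AllPairs (λ a b → ¬ Forbidden (dist a b)) L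
          × ¬ (1 ∈ L × 3 ∈ L)

HasFQDecomp : (ℕ → ℕ) → ℕ → ℕ → Set
HasFQDecomp q i m =
  ∃ λ (L : List ℕ) → FQLegal L
                   × All (λ ℓ → 1 ≤ ℓ × ℓ < i) L
                   × sum (map q L) ≡ m

-- q (indexed from 1; q 0 is irrelevant) is the Fibonacci Quilt sequence:
-- it is increasing, and each q i is the smallest positive integer with no
-- FQ-legal decomposition using q₁, …, q_{i-1}.
IsFibonacciQuilt : (ℕ → ℕ) → Set
IsFibonacciQuilt q =
  (∀ i → 1 ≤ i → q i < q (suc i))
  × (∀ i → 1 ≤ i →
       (0 < q i)
       × ¬ HasFQDecomp q i (q i)
       × (∀ m → 0 < m → m < q i → HasFQDecomp q i m))

-- The sequence is 1, 2, 3, 4, 5, 7, 9, … with q(n) = q(n-2) + q(n-3) from q(6) on.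
-- Each identity holds for this explicit sequence because both of its sides
-- satisfy that third-order linear recurrence and agree at three consecutive
-- indices. The sequence described by the minimality condition is the explicit
-- one by strong induction: greedily removing q(k) decomposes every m < q(k+1)
-- with indices at most k, while an FQ-legal decomposition with largest index
-- k < j never sums to q(j), because removing q(k) from q(k+1) = q(k) + q(k-4)
-- or q(k+2) = q(k) + q(k-1) leaves a smaller instance of the same situation,
-- and such a decomposition always sums to less than q(k+3).
module Submission where

open import Defs
open import Data.Nat using (ℕ; zero; suc; _+_; _*_; _∸_; _≤_; _<_; z≤n; s≤s; _<?_; _≟_; >-nonZero)
open import Data.Nat.Properties
open import Data.Nat.ListAction using (sum)
open import Data.List using (List; []; _∷_; map)
open import Data.List.Relation.Unary.All as All using (All; []; _∷_)
open import Data.List.Relation.Unary.AllPairs using ([]; _∷_)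
open import Data.List.Relation.Unary.Any using (here; there)
open import Data.List.Membership.Propositional using (_∈_)
open import Data.Product using (_×_; _,_; proj₁)
open import Data.Sum using (_⊎_; inj₁; inj₂)
open import Data.Empty using (⊥-elim)
open import Relation.Nullary using (¬_; yes; no)
open import Relation.Binary.Definitions using (tri<; tri≈; tri>)
open import Relation.Binary.PropositionalEquality using (_≡_; _≢_; refl; sym; trans; cong; cong₂; subst)
open import Algebra.Properties.CommutativeSemigroup +-commutativeSemigroup using (interchange)

record Recurrent (a : ℕ → ℕ) : Set where
  constructor recurrent
  field recurrence : ∀ k → a (3 + k) ≡ a (1 + k) + a k

recurrent-shift : ∀ {a} c → Recurrent a → Recurrent (λ k → a (c + k))
recurrent-shift     zero    rec             = rec
recurrent-shift {a} (suc c) (recurrent rec) =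
  recurrent-shift {λ k → a (suc k)} c (recurrent (λ k → rec (suc k)))

recurrent-+ : ∀ {a b} → Recurrent a → Recurrent b → Recurrent (λ k → a k + b k)
recurrent-+ {a} {b} (recurrent recA) (recurrent recB) = recurrent λ k →
  trans (cong₂ _+_ (recA k) (recB k)) (interchange (a (1 + k)) (a k) (b (1 + k)) (b k))

recurrent-unique : ∀ {a b} → Recurrent a → Recurrent b →
                   a 0 ≡ b 0 → a 1 ≡ b 1 → a 2 ≡ b 2 → ∀ k → a k ≡ b k
recurrent-unique _ _ e₀ e₁ e₂ 0 = e₀
recurrent-unique _ _ e₀ e₁ e₂ 1 = e₁
recurrent-unique _ _ e₀ e₁ e₂ 2 = e₂
recurrent-unique {a} {b} recA@(recurrent rA) recB@(recurrent rB) e₀ e₁ e₂ (suc (suc (suc k))) =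
  trans (rA k) (trans (cong₂ _+_ (unique (suc k)) (unique k)) (sym (rB k)))
  where
  unique : ∀ k → a k ≡ b k
  unique = recurrent-unique recA recB e₀ e₁ e₂

-- The explicit Fibonacci Quilt sequence; the value at 0 is the junk value 0.
quilt : ℕ → ℕ
quilt 0 = 0
quilt 1 = 1
quilt 2 = 2
quilt 3 = 3
quilt 4 = 4
quilt 5 = 5
quilt (suc (suc (suc (suc (suc (suc n)))))) =
  quilt (suc (suc (suc (suc n)))) + quilt (suc (suc (suc n)))

quilt-recurrence : ∀ k → quilt (5 + k) ≡ quilt (3 + k) + quilt (2 + k)
quilt-recurrence zero    = refl
quilt-recurrence (suc k) = refl

quilt-recurrent : Recurrent (λ k → quilt (2 + k))
quilt-recurrent = recurrent quilt-recurrence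

quilt-shifts-recurrent : ∀ c d → Recurrent (λ k → quilt (2 + c + k) + quilt (2 + d + k))
quilt-shifts-recurrent c d =
  recurrent-+ (recurrent-shift c quilt-recurrent) (recurrent-shift d quilt-recurrent)

quilt-identity₁ : ∀ k → 2 * quilt (7 + k) ≡ quilt (9 + k) + quilt (2 + k)
quilt-identity₁ k = trans (cong (quilt (7 + k) +_) (+-identityʳ (quilt (7 + k))))
  (recurrent-unique (quilt-shifts-recurrent 5 5) (quilt-shifts-recurrent 7 0) refl refl refl k)

quilt-identity₂ : ∀ k → quilt (8 + k) + quilt (6 + k) ≡ quilt (9 + k) + quilt (3 + k)
quilt-identity₂ =
  recurrent-unique (quilt-shifts-recurrent 6 4) (quilt-shifts-recurrent 7 1) refl refl refl

quilt-identity₃ : ∀ k → quilt (10 + k) + quilt (7 + k) ≡ quilt (11 + k) + quilt (2 + k)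
quilt-identity₃ =
  recurrent-unique (quilt-shifts-recurrent 8 5) (quilt-shifts-recurrent 9 0) refl refl refl

quilt-3+ : ∀ {k} → 2 ≤ k → quilt (3 + k) ≡ quilt (1 + k) + quilt k
quilt-3+ 2≤k with m≤n⇒∃[o]m+o≡n 2≤k
... | n , refl = quilt-recurrence n

quilt-2+ : ∀ {k} → 3 ≤ k → quilt (2 + k) ≡ quilt k + quilt (k ∸ 1)
quilt-2+ 3≤k with m≤n⇒∃[o]m+o≡n 3≤k
... | n , refl = quilt-recurrence n

quilt-1+ : ∀ {k} → 6 ≤ k → quilt (1 + k) ≡ quilt k + quilt (k ∸ 4)
quilt-1+ 6≤k with m≤n⇒∃[o]m+o≡n 6≤k
... | n , refl = recurrent-unique (recurrent-shift 5 quilt-recurrent)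
                   (quilt-shifts-recurrent 4 0) refl refl refl n

quilt-positive : ∀ {n} → 1 ≤ n → 0 < quilt n
quilt-positive {1} _ = s≤s z≤n
quilt-positive {2} _ = s≤s z≤n
quilt-positive {3} _ = s≤s z≤n
quilt-positive {4} _ = s≤s z≤n
quilt-positive {5} _ = s≤s z≤n
quilt-positive {suc (suc (suc (suc (suc (suc n)))))} _ =
  <-≤-trans (quilt-positive {suc (suc (suc (suc n)))} (s≤s z≤n)) (m≤m+n _ _)

quilt-<-suc : ∀ n → quilt n < quilt (suc n)
quilt-<-suc 0 = n<1+n 0
quilt-<-suc 1 = n<1+n 1
quilt-<-suc 2 = n<1+n 2
quilt-<-suc 3 = n<1+n 3
quilt-<-suc 4 = n<1+n 4
quilt-<-suc 5 = m<m+n 5 (s≤s z≤n)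
quilt-<-suc (suc (suc (suc (suc (suc (suc n)))))) =
  subst (quilt (6 + n) <_) (sym (quilt-1+ (m≤m+n 6 n)))
    (m<m+n (quilt (6 + n)) (quilt-positive {2 + n} (s≤s z≤n)))

quilt-mono-< : ∀ {a b} → a < b → quilt a < quilt b
quilt-mono-< {a} {suc b} (s≤s a≤b) with m≤n⇒m<n∨m≡n a≤b
... | inj₁ a<b  = <-trans (quilt-mono-< a<b) (quilt-<-suc b)
... | inj₂ refl = quilt-<-suc a

quilt-mono-≤ : ∀ {a b} → a ≤ b → quilt a ≤ quilt b
quilt-mono-≤ a≤b with m≤n⇒m<n∨m≡n a≤b
... | inj₁ a<b  = <⇒≤ (quilt-mono-< a<b)
... | inj₂ refl = ≤-refl

quilt-3+<quilt-2++quilt : ∀ {i} → 2 ≤ i → quilt (3 + i) < quilt (2 + i) + quilt i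
quilt-3+<quilt-2++quilt {i} 2≤i =
  subst (_< quilt (2 + i) + quilt i) (sym (quilt-3+ 2≤i)) (+-monoˡ-< (quilt i) (quilt-<-suc (1 + i)))

allowed-gap : ∀ {x k} → x < k → ¬ Forbidden (dist k x) → 2 + x ≡ k ⊎ 5 + x ≤ k
allowed-gap {suc x} {suc k} (s≤s x<k) allowed with allowed-gap x<k allowed
... | inj₁ eq = inj₁ (cong suc eq)
... | inj₂ le = inj₂ (s≤s le)
allowed-gap {zero} {1} _ allowed = ⊥-elim (allowed (inj₂ (inj₁ refl)))
allowed-gap {zero} {2} _ allowed = inj₁ refl
allowed-gap {zero} {3} _ allowed = ⊥-elim (allowed (inj₂ (inj₂ (inj₁ refl))))
allowed-gap {zero} {4} _ allowed = ⊥-elim (allowed (inj₂ (inj₂ (inj₂ refl))))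
allowed-gap {zero} {suc (suc (suc (suc (suc k))))} _ _ = inj₂ (s≤s (s≤s (s≤s (s≤s (s≤s z≤n)))))

distant⇒allowed : ∀ {x k} → 5 + x ≤ k → ¬ Forbidden (dist k x)
distant⇒allowed {suc x} {suc k} (s≤s le) = distant⇒allowed le
distant⇒allowed {zero} (s≤s (s≤s (s≤s (s≤s (s≤s _))))) (inj₁ ())
distant⇒allowed {zero} (s≤s (s≤s (s≤s (s≤s (s≤s _))))) (inj₂ (inj₁ ()))
distant⇒allowed {zero} (s≤s (s≤s (s≤s (s≤s (s≤s _))))) (inj₂ (inj₂ (inj₁ ())))
distant⇒allowed {zero} (s≤s (s≤s (s≤s (s≤s (s≤s _))))) (inj₂ (inj₂ (inj₂ ())))

legal-tail : ∀ {k L} → FQLegal (k ∷ L) → FQLegal L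
legal-tail (_ ∷ decreasing , _ ∷ allowed , not13) =
  decreasing , allowed , λ (1∈ , 3∈) → not13 (there 1∈ , there 3∈)

legal-gap : ∀ {k i L} → FQLegal (k ∷ i ∷ L) → 2 + i ≡ k ⊎ 5 + i ≤ k
legal-gap ((i<k ∷ _) ∷ _ , (allowed ∷ _) ∷ _ , _) = allowed-gap i<k allowed

legal-gap≥2 : ∀ {k i L} → FQLegal (k ∷ i ∷ L) → 2 + i ≤ k
legal-gap≥2 {i = i} legal with legal-gap legal
... | inj₁ refl = ≤-refl
... | inj₂ 5+i≤k = ≤-trans (m≤n+m (2 + i) 3) 5+i≤k

legal-2+i∷i⇒2≤i : ∀ {i L} → FQLegal (2 + i ∷ i ∷ L) → 1 ≤ i → 2 ≤ i
legal-2+i∷i⇒2≤i {1} (_ , _ , not13) _ = ⊥-elim (not13 (there (here refl) , here refl))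
legal-2+i∷i⇒2≤i {suc (suc _)} _ _ = s≤s (s≤s z≤n)

value : List ℕ → ℕ
value L = sum (map quilt L)

value-< : ∀ k L → FQLegal (k ∷ L) → value (k ∷ L) < quilt (3 + k)
value-< k [] _ = begin-strict
  quilt k + 0    ≡⟨ +-identityʳ (quilt k) ⟩
  quilt k        <⟨ quilt-mono-< (m<n+m k {3} (s≤s z≤n)) ⟩
  quilt (3 + k)  ∎
  where open ≤-Reasoning
value-< k (i ∷ L) legal = begin-strict
  quilt k + value (i ∷ L)  <⟨ +-monoʳ-< (quilt k) value<quilt[1+k] ⟩
  quilt k + quilt (1 + k)  ≡⟨ +-comm (quilt k) (quilt (1 + k)) ⟩
  quilt (1 + k) + quilt k  ≡⟨ quilt-3+ (≤-trans (m≤m+n 2 i) 2+i≤k) ⟨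
  quilt (3 + k)            ∎
  where
  open ≤-Reasoning
  2+i≤k : 2 + i ≤ k
  2+i≤k = legal-gap≥2 legal
  value<quilt[1+k] : value (i ∷ L) < quilt (1 + k)
  value<quilt[1+k] = <-≤-trans (value-< i L (legal-tail legal)) (quilt-mono-≤ (s≤s 2+i≤k))

split-< : ∀ {k j} → k < j → j ≡ 1 + k ⊎ j ≡ 2 + k ⊎ 3 + k ≤ j
split-< k<j with m≤n⇒m<n∨m≡n k<j
... | inj₂ refl = inj₁ refl
... | inj₁ 1+k<j with m≤n⇒m<n∨m≡n 1+k<j
...   | inj₂ refl  = inj₂ (inj₁ refl)
...   | inj₁ 2+k<j = inj₂ (inj₂ 2+k<j)

value-≢-quilt : ∀ {k j} L → FQLegal (k ∷ L) → All (1 ≤_) (k ∷ L) → k < j → value (k ∷ L) ≢ quilt j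
value-≢-quilt {k} [] _ _ k<j eq =
  <⇒≢ (quilt-mono-< k<j) (trans (sym (+-identityʳ (quilt k))) eq)
value-≢-quilt {k} (i ∷ L) legal (_ ∷ 1≤i ∷ positive) k<j eq with split-< k<j
... | inj₂ (inj₂ 3+k≤j) = <⇒≢ (<-≤-trans (value-< k (i ∷ L) legal) (quilt-mono-≤ 3+k≤j)) eq
... | inj₂ (inj₁ refl) =
  value-≢-quilt L (legal-tail legal) (1≤i ∷ positive) (∸-monoˡ-≤ 1 2+i≤k)
    (+-cancelˡ-≡ (quilt k) _ _ (trans eq (quilt-2+ (≤-trans (+-monoʳ-≤ 2 1≤i) 2+i≤k))))
  where
  2+i≤k : 2 + i ≤ k
  2+i≤k = legal-gap≥2 legal
... | inj₁ refl with legal-gap legal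
...   | inj₁ refl = <⇒≢ (<-≤-trans (quilt-3+<quilt-2++quilt (legal-2+i∷i⇒2≤i legal 1≤i))
                                  (+-monoʳ-≤ (quilt k) (m≤m+n (quilt i) (value L)))) (sym eq)
...   | inj₂ 5+i≤k =
  value-≢-quilt L (legal-tail legal) (1≤i ∷ positive) (∸-monoˡ-≤ 4 5+i≤k)
    (+-cancelˡ-≡ (quilt k) _ _ (trans eq (quilt-1+ (≤-trans (+-monoʳ-≤ 5 1≤i) 5+i≤k))))

quilt-indecomposable : ∀ {i} → 1 ≤ i → ¬ HasFQDecomp quilt i (quilt i)
quilt-indecomposable 1≤i ([] , _ , _ , 0≡quilt) = <⇒≢ (quilt-positive 1≤i) 0≡quilt
quilt-indecomposable _ (k ∷ L , legal , bounds@((_ , k<i) ∷ _) , eq) =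
  value-≢-quilt L legal (All.map proj₁ bounds) k<i eq

module _ {q : ℕ → ℕ} where

  []-decomp : ∀ {i} → HasFQDecomp q i 0
  []-decomp = [] , ([] , [] , λ ()) , [] , refl

  [-]-decomp : ∀ {i k} → 1 ≤ k → k < i → HasFQDecomp q i (q k)
  [-]-decomp {k = k} 1≤k k<i =
    k ∷ [] , ([] ∷ [] , [] ∷ [] , not13) , (1≤k , k<i) ∷ [] , +-identityʳ (q k)
    where
    not13 : ¬ (1 ∈ k ∷ [] × 3 ∈ k ∷ [])
    not13 (here refl , here ())

  decomp-suc : ∀ {i m} → HasFQDecomp q i m → HasFQDecomp q (suc i) m
  decomp-suc (L , legal , bounds , eq) =
    L , legal , All.map (λ (1≤ℓ , ℓ<i) → 1≤ℓ , m<n⇒m<1+n ℓ<i) bounds , eq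

  -- All indices below i lie at distance at least 5 from 4 + i.
  decomp-cons : ∀ {i r} → HasFQDecomp q i r → HasFQDecomp q (5 + i) (q (4 + i) + r)
  decomp-cons {i} (L , (decreasing , allowed , not13) , bounds , eq) =
    4 + i ∷ L ,
    (All.map (λ (_ , ℓ<i) → ≤-trans ℓ<i (m≤n+m i 4)) bounds ∷ decreasing ,
     All.map (λ (_ , ℓ<i) → distant⇒allowed (+-monoʳ-≤ 4 ℓ<i)) bounds ∷ allowed ,
     not13′) ,
    (s≤s z≤n , ≤-refl) ∷ All.map (λ (1≤ℓ , ℓ<i) → 1≤ℓ , ≤-trans ℓ<i (m≤n+m i 5)) bounds ,
    cong (q (4 + i) +_) eq
    where
    not13′ : ¬ (1 ∈ 4 + i ∷ L × 3 ∈ 4 + i ∷ L)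
    not13′ (there 1∈ , there 3∈) = not13 (1∈ , 3∈)

  decomp-cong : ∀ {r i m} → (∀ ℓ → 1 ≤ ℓ → ℓ < i → q ℓ ≡ r ℓ) →
                HasFQDecomp q i m → HasFQDecomp r i m
  decomp-cong {r} agree (L , legal , bounds , eq) =
    L , legal , bounds , trans (sym (sum-cong L bounds)) eq
    where
    sum-cong : ∀ L → All (λ ℓ → 1 ≤ ℓ × ℓ < _) L → sum (map q L) ≡ sum (map r L)
    sum-cong [] [] = refl
    sum-cong (ℓ ∷ L) ((1≤ℓ , ℓ<i) ∷ bounds) = cong₂ _+_ (agree ℓ 1≤ℓ ℓ<i) (sum-cong L bounds)

-- Greedy fails at 6: 6 = q(5) + q(1) is not legal, as 5 - 1 = 4.
quilt-decomp-6 : HasFQDecomp quilt 6 6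
quilt-decomp-6 =
  4 ∷ 2 ∷ [] ,
  ((s≤s (s≤s (s≤s z≤n)) ∷ []) ∷ [] ∷ [] , (distance-2-allowed ∷ []) ∷ [] ∷ [] , not13) ,
  (s≤s z≤n , s≤s (s≤s (s≤s (s≤s (s≤s z≤n))))) ∷ (s≤s z≤n , s≤s (s≤s (s≤s z≤n))) ∷ [] ,
  refl
  where
  distance-2-allowed : ¬ Forbidden 2
  distance-2-allowed (inj₂ (inj₂ (inj₁ ())))
  distance-2-allowed (inj₂ (inj₂ (inj₂ ())))
  not13 : ¬ (1 ∈ 4 ∷ 2 ∷ [] × 3 ∈ 4 ∷ 2 ∷ [])
  not13 (there (there ()) , _)

tight-decomp : ∀ {i k m} → 1 ≤ k → k < i → quilt k ≤ m → m < suc (quilt k) → HasFQDecomp quilt i m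
tight-decomp 1≤k k<i quilt[k]≤m m<1+quilt[k] with ≤-antisym (≤-pred m<1+quilt[k]) quilt[k]≤m
... | refl = [-]-decomp 1≤k k<i

mutual
  decompose : ∀ i m → m < quilt i → HasFQDecomp quilt i m
  decompose zero _ ()
  decompose (suc k) m m<quilt[1+k] with m <? quilt k
  ... | yes m<quilt[k] = decomp-suc (decompose k m m<quilt[k])
  ... | no  m≮quilt[k] = decompose-greedy k m (≮⇒≥ m≮quilt[k]) m<quilt[1+k]

  decompose-greedy : ∀ k m → quilt k ≤ m → m < quilt (suc k) → HasFQDecomp quilt (suc k) m
  decompose-greedy 0 _ _ (s≤s z≤n) = []-decomp
  decompose-greedy 1 _ = tight-decomp (s≤s z≤n) ≤-refl
  decompose-greedy 2 _ = tight-decomp (s≤s z≤n) ≤-refl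
  decompose-greedy 3 _ = tight-decomp (s≤s z≤n) ≤-refl
  decompose-greedy 4 _ = tight-decomp (s≤s z≤n) ≤-refl
  decompose-greedy 5 m 5≤m m<7 with m ≟ 6
  ... | yes refl = quilt-decomp-6
  ... | no  m≢6  = tight-decomp (s≤s z≤n) ≤-refl 5≤m (≤∧≢⇒< (≤-pred m<7) m≢6)
  decompose-greedy (suc (suc (suc (suc (suc (suc n)))))) m quilt[k]≤m m<quilt[1+k] =
    subst (HasFQDecomp quilt (7 + n)) (m+[n∸m]≡n quilt[k]≤m)
      (decomp-cons (decompose (suc (suc n)) (m ∸ quilt (6 + n)) remainder<))
    where
    remainder< : m ∸ quilt (6 + n) < quilt (2 + n)
    remainder< = m<n+o⇒m∸n<o m (quilt (6 + n)) {{>-nonZero (quilt-positive {2 + n} (s≤s z≤n))}}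
      (subst (m <_) (quilt-1+ (m≤m+n 6 n)) m<quilt[1+k])

isFibonacciQuilt⇒≡quilt : ∀ {q} → IsFibonacciQuilt q → ∀ n → 1 ≤ n → q n ≡ quilt n
isFibonacciQuilt⇒≡quilt {q} (_ , minimal) n 1≤n = agreeBelow (suc n) n 1≤n ≤-refl
  where
  AgreeBelow : ℕ → Set
  AgreeBelow i = ∀ ℓ → 1 ≤ ℓ → ℓ < i → q ℓ ≡ quilt ℓ

  agree-at : ∀ i → 1 ≤ i → AgreeBelow i → q i ≡ quilt i
  agree-at i 1≤i below with <-cmp (q i) (quilt i) | minimal i 1≤i
  ... | tri≈ _ q≡quilt _ | _ = q≡quilt
  ... | tri< q<quilt _ _ | _ , q-indecomposable , _ =
    ⊥-elim (q-indecomposable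
      (decomp-cong (λ ℓ 1≤ℓ ℓ<i → sym (below ℓ 1≤ℓ ℓ<i)) (decompose i (q i) q<quilt)))
  ... | tri> _ _ quilt<q | _ , _ , q-decomposable =
    ⊥-elim (quilt-indecomposable 1≤i
      (decomp-cong below (q-decomposable (quilt i) (quilt-positive 1≤i) quilt<q)))

  agreeBelow : ∀ i → AgreeBelow i
  agreeBelow (suc i) ℓ 1≤ℓ (s≤s ℓ≤i) with m≤n⇒m<n∨m≡n ℓ≤i
  ... | inj₁ ℓ<i  = agreeBelow i ℓ 1≤ℓ ℓ<i
  ... | inj₂ refl = agree-at ℓ 1≤ℓ (agreeBelow ℓ)

lemma4p3 : (q : ℕ → ℕ) → IsFibonacciQuilt q →
    (∀ n → 7 ≤ n → 2 * q n ≡ q (n + 2) + q (n ∸ 5))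
    × (∀ n → 8 ≤ n → q n + q (n ∸ 2) ≡ q (n + 1) + q (n ∸ 5))
    × (∀ n → 10 ≤ n → q n + q (n ∸ 3) ≡ q (n + 1) + q (n ∸ 8))
lemma4p3 q isQuilt = identity₁ , identity₂ , identity₃
  where
  q≡quilt : ∀ n → q (suc n) ≡ quilt (suc n)
  q≡quilt n = isFibonacciQuilt⇒≡quilt isQuilt (suc n) (s≤s z≤n)

  q[1+n+c]≡quilt[c+1+n] : ∀ n c → q (suc n + c) ≡ quilt (c + suc n)
  q[1+n+c]≡quilt[c+1+n] n c = trans (q≡quilt (n + c)) (cong quilt (+-comm (suc n) c))

  identity₁ : ∀ n → 7 ≤ n → 2 * q n ≡ q (n + 2) + q (n ∸ 5)
  identity₁ n 7≤n with m≤n⇒∃[o]m+o≡n 7≤n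
  ... | k , refl = trans (cong (2 *_) (q≡quilt (6 + k))) (trans (quilt-identity₁ k)
    (sym (cong₂ _+_ (q[1+n+c]≡quilt[c+1+n] (6 + k) 2) (q≡quilt (1 + k)))))

  identity₂ : ∀ n → 8 ≤ n → q n + q (n ∸ 2) ≡ q (n + 1) + q (n ∸ 5)
  identity₂ n 8≤n with m≤n⇒∃[o]m+o≡n 8≤n
  ... | k , refl = trans (cong₂ _+_ (q≡quilt (7 + k)) (q≡quilt (5 + k))) (trans (quilt-identity₂ k)
    (sym (cong₂ _+_ (q[1+n+c]≡quilt[c+1+n] (7 + k) 1) (q≡quilt (2 + k)))))

  identity₃ : ∀ n → 10 ≤ n → q n + q (n ∸ 3) ≡ q (n + 1) + q (n ∸ 8)
  identity₃ n 10≤n with m≤n⇒∃[o]m+o≡n 10≤n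
  ... | k , refl = trans (cong₂ _+_ (q≡quilt (9 + k)) (q≡quilt (6 + k))) (trans (quilt-identity₃ k)
    (sym (cong₂ _+_ (q[1+n+c]≡quilt[c+1+n] (9 + k) 1) (q≡quilt (1 + k)))))
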